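{- Let $k$, $p$, $c$ be integers with $k \geq 0$, $p \geq 1$, $c \geq 3$ and $k<c$. Let $G=(V,E)$ be a $k$-FT($pK_c$) graph with $|V|=pc+k$. Let $W\subset V$ with $|W|=k$ be a separator in $G$, and let $A_1,\dots,A_z$ be the connected components of $G-W$. Then for every vertex $x\in W$ and every $i$, $1 \leq i \leq z$, there exists $V_{i,x} \subset V(A_i)$ with $|V_{i,x}|=c-1$ such that $\{x\} \cup V_{i,x}$ is a clique.
   Context: All graphs are finite, simple and undirected. For integers $k\ge 0$, $p\ge 1$, $c\ge 2$, a graph $G=(V,E)$ is called $k$-FT($pK_c$) if for every $S\subset V$ with $|S|\le k$, the graph $G-S$ contains as a subgraph the disjoint union of $p$ complete graphs $K_c$. A separator of $G$ is a set $W\subset V$ such that $G-W$ is disconnected. A clique is a set of pairwise adjacent vertices. -}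

module Defs where

open import Data.Nat using (ℕ; _≤_; _*_; _+_; _∸_)
open import Data.Bool using (Bool; true)
open import Data.Fin using (Fin)
open import Data.Fin.Subset using (Subset; _∈_; _∉_; ∣_∣; ⁅_⁆; _∪_)
open import Data.Product using (∃; _×_; Σ)
open import Relation.Binary.PropositionalEquality using (_≡_; _≢_)
open import Relation.Nullary using (¬_)
import Data.Empty
open import Function.Definitions using (Injective)

record Graph (n : ℕ) : Set where
  field
    adj    : Fin n → Fin n → Bool
    sym    : ∀ u v → adj u v ≡ adj v u
    irrefl : ∀ u → adj u u ≡ true → Data.Empty.⊥
open Graph public

Edge : ∀ {n} → Graph n → Fin n → Fin n → Set
Edge G u v = adj G u v ≡ true

-- G - S contains p vertex-disjoint copies of K_c as a subgraph:
-- an injective placement f of the vertices of pK_c avoiding S,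
-- with distinct vertices of the same copy mapped to adjacent vertices.
ContainsPKc-avoiding : ∀ {n} → Graph n → Subset n → ℕ → ℕ → Set
ContainsPKc-avoiding {n} G S p c =
  Σ (Fin p × Fin c → Fin n) λ f →
    Injective _≡_ _≡_ f ×
    (∀ i a → f (i Data.Product., a) ∉ S) ×
    (∀ i a b → a ≢ b → Edge G (f (i Data.Product., a)) (f (i Data.Product., b)))

FT : ∀ {n} → ℕ → ℕ → ℕ → Graph n → Set
FT {n} k p c G = ∀ (S : Subset n) → ∣ S ∣ ≤ k → ContainsPKc-avoiding G S p c

data Reach {n} (G : Graph n) (W : Subset n) (u : Fin n) : Fin n → Set where
  here : u ∉ W → Reach G W u u
  step : ∀ {v w} → Reach G W u v → Edge G v w → w ∉ W → Reach G W u w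

Separator : ∀ {n} → Graph n → Subset n → Set
Separator {n} G W = Σ (Fin n) λ u → Σ (Fin n) λ v →
  u ∉ W × v ∉ W × ¬ Reach G W u v

IsClique : ∀ {n} → Graph n → Subset n → Set
IsClique G C = ∀ u v → u ∈ C → v ∈ C → u ≢ v → Edge G u v

-- Let C be the component of G − W containing y. Removing the k vertices of W leaves exactly pc
-- vertices, so a pK_c avoiding W covers V ∖ W; each copy avoids W and is connected, hence lies
-- inside C or misses it, and c divides |C|. Now remove S = (W − x) ∪ {y}, again k vertices:
-- the copies cover V ∖ S, so one copy Q contains x. If the other c − 1 vertices of Q lie in C
-- they are the required clique. Otherwise Q misses C, the copies cover C − y and each lies inside
-- it or misses it, so c also divides |C| − 1, which is impossible for c ≥ 2.

module Submission where

open import Data.Bool using (true)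
import Data.Bool as Bool
open import Data.Empty using (⊥-elim)
open import Data.Fin using (Fin; zero; suc; _≟_; remQuot; combine; punchIn)
open import Data.Fin.Properties
  using (suc-injective; 0≢1+n; ¬Fin0; any?; combine-remQuot; punchIn-injective; punchInᵢ≢i)
open import Data.Fin.Subset
open import Data.Fin.Subset.Properties
open import Data.Nat using (ℕ; zero; suc; _+_; _*_; _∸_; _≤_; _<_; s≤s; z≤n)
open import Data.Nat.Divisibility using (_∣_; _∣0; ∣-refl; ∣m∣n⇒∣m+n; ∣m+n∣m⇒∣n; ∣1⇒≡1)
open import Data.Nat.GeneralisedArithmetic using (fold)
open import Data.Nat.Properties
  using (+-suc; +-comm; m<m+n; <⇒≱; ≤-trans; ≤-reflexive; m+n∸n≡m)
open import Data.Product using (Σ; ∃; _×_; _,_; proj₁; proj₂; curry; uncurry)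
import Data.Product as Product
open import Data.Product.Properties using (,-injectiveˡ; ,-injectiveʳ)
open import Data.Sum using (_⊎_; inj₁; inj₂; [_,_])
open import Data.Vec using ([]; _∷_; here; there; tabulate)
open import Data.Vec.Properties using (lookup∘tabulate; []=⇒lookup; lookup⇒[]=)
open import Function using (_∘_; id)
open import Function.Definitions using (Injective)
open import Level using (Level)
open import Relation.Binary.PropositionalEquality
  using (_≡_; _≢_; refl; sym; trans; cong; subst; module ≡-Reasoning)
open import Relation.Nullary using (¬_; yes; no; does; contradiction; ¬?)
open import Relation.Nullary.Decidable using (_×-dec_; dec-true; dec-false; decidable-stable)
open import Relation.Unary using (Pred; Decidable)

open import Defs hiding (sym)

private variable
  ℓ : Level
  m n : ℕ

∣1+m∧∣m⇒≡1 : ∀ {d m} → d ∣ suc m → d ∣ m → d ≡ 1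
∣1+m∧∣m⇒≡1 {d} {m} d∣1+m d∣m = ∣1⇒≡1 (∣m+n∣m⇒∣n (subst (d ∣_) (+-comm 1 m) d∣1+m) d∣m)

subset : {P : Pred (Fin n) ℓ} → Decidable P → Subset n
subset P? = tabulate (λ v → does (P? v))

module _ {P : Pred (Fin n) ℓ} (P? : Decidable P) where

  ∈-subset⁺ : ∀ {v} → P v → v ∈ subset P?
  ∈-subset⁺ {v} Pv = lookup⇒[]= v _ (trans (lookup∘tabulate _ v) (dec-true (P? v) Pv))

  ∈-subset⁻ : ∀ {v} → v ∈ subset P? → P v
  ∈-subset⁻ {v} v∈ = decidable-stable (P? v) λ ¬Pv →
    contradiction (trans (sym P?-true) (dec-false (P? v) ¬Pv)) λ ()
    where
    P?-true : does (P? v) ≡ true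
    P?-true = trans (sym (lookup∘tabulate _ v)) ([]=⇒lookup v∈)

x∈q⇒x∉p─q : ∀ (p q : Subset n) {x} → x ∈ q → x ∉ p ─ q
x∈q⇒x∉p─q (s ∷ p) (inside ∷ q) here ()
x∈q⇒x∉p─q (s ∷ p) (t ∷ q) (there x∈q) (there x∈p─q) = x∈q⇒x∉p─q p q x∈q x∈p─q

∣p∣≡∣q∣+∣p─q∣ : ∀ {p q : Subset n} → q ⊆ p → ∣ p ∣ ≡ ∣ q ∣ + ∣ p ─ q ∣
∣p∣≡∣q∣+∣p─q∣ {p = []} {[]} _ = refl
∣p∣≡∣q∣+∣p─q∣ {p = outside ∷ p} {inside ∷ q} q⊆p with () ← q⊆p here
∣p∣≡∣q∣+∣p─q∣ {p = inside ∷ p} {inside ∷ q} q⊆p =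
  cong suc (∣p∣≡∣q∣+∣p─q∣ (drop-there ∘ q⊆p ∘ there))
∣p∣≡∣q∣+∣p─q∣ {p = inside ∷ p} {outside ∷ q} q⊆p =
  trans (cong suc (∣p∣≡∣q∣+∣p─q∣ (drop-there ∘ q⊆p ∘ there))) (sym (+-suc _ _))
∣p∣≡∣q∣+∣p─q∣ {p = outside ∷ p} {outside ∷ q} q⊆p = ∣p∣≡∣q∣+∣p─q∣ (drop-there ∘ q⊆p ∘ there)

∣p∣≡1+∣p-x∣ : ∀ {p : Subset n} {x} → x ∈ p → ∣ p ∣ ≡ suc ∣ p - x ∣
∣p∣≡1+∣p-x∣ {p = p} {x} x∈p =
  trans (∣p∣≡∣q∣+∣p─q∣ (λ y∈⁅x⁆ → subst (_∈ _) (sym (x∈⁅y⁆⇒x≡y x y∈⁅x⁆)) x∈p))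
        (cong (_+ ∣ p - x ∣) (∣⁅x⁆∣≡1 x))

∣p∪⁅x⁆∣≡1+∣p∣ : ∀ {p : Subset n} {x} → x ∉ p → ∣ p ∪ ⁅ x ⁆ ∣ ≡ suc ∣ p ∣
∣p∪⁅x⁆∣≡1+∣p∣ {p = outside ∷ p} {zero} _ = cong (suc ∘ ∣_∣) (∪-identityʳ p)
∣p∪⁅x⁆∣≡1+∣p∣ {p = inside ∷ p} {zero} x∉p = contradiction here x∉p
∣p∪⁅x⁆∣≡1+∣p∣ {p = inside ∷ p} {suc x} x∉p = cong suc (∣p∪⁅x⁆∣≡1+∣p∣ (x∉p ∘ there))
∣p∪⁅x⁆∣≡1+∣p∣ {p = outside ∷ p} {suc x} x∉p = ∣p∪⁅x⁆∣≡1+∣p∣ (x∉p ∘ there)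

∣p─q∣≡0⇒p⊆q : ∀ {p q : Subset n} → ∣ p ─ q ∣ ≡ 0 → p ⊆ q
∣p─q∣≡0⇒p⊆q {p = p} {q} ∣p─q∣≡0 {x} x∈p with x ∈? q
... | yes x∈q = x∈q
... | no x∉q with () ← trans (sym ∣p─q∣≡0) (∣p∣≡1+∣p-x∣ (x∈p∧x∉q⇒x∈p─q x∈p x∉q))

p⊆q⇒q⊆p⊎∣p∣<∣q∣ : ∀ {p q : Subset n} → p ⊆ q → q ⊆ p ⊎ ∣ p ∣ < ∣ q ∣
p⊆q⇒q⊆p⊎∣p∣<∣q∣ {p = p} {q} p⊆q with ∣ q ─ p ∣ in eq
... | zero = inj₁ (∣p─q∣≡0⇒p⊆q eq)
... | suc _ = inj₂ (subst (∣ p ∣ <_) (sym (trans (∣p∣≡∣q∣+∣p─q∣ p⊆q) (cong (∣ p ∣ +_) eq)))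
                         (m<m+n ∣ p ∣ (s≤s z≤n)))

∣p∣≡k⇒∣∁p∣≡m : ∀ {m k} (S : Subset (m + k)) → ∣ S ∣ ≡ k → ∣ ∁ S ∣ ≡ m
∣p∣≡k⇒∣∁p∣≡m {m} {k} S ∣S∣≡k = trans (∣∁p∣≡n∸∣p∣ S) (trans (cong (m + k ∸_) ∣S∣≡k) (m+n∸n≡m m k))

image : (Fin m → Fin n) → Subset n
image {zero} g = ⊥
image {suc m} g = image (g ∘ suc) ∪ ⁅ g zero ⁆

∈-image : ∀ (g : Fin m → Fin n) j → g j ∈ image g
∈-image g zero = q⊆p∪q _ _ (x∈⁅x⁆ (g zero))
∈-image g (suc j) = p⊆p∪q _ (∈-image (g ∘ suc) j)

∈-image⁻ : ∀ (g : Fin m → Fin n) {v} → v ∈ image g → ∃ λ j → g j ≡ v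
∈-image⁻ {zero} g v∈ = contradiction v∈ ∉⊥
∈-image⁻ {suc m} g v∈ with x∈p∪q⁻ _ _ v∈
... | inj₁ v∈′ = Product.map suc id (∈-image⁻ (g ∘ suc) v∈′)
... | inj₂ v∈⁅g0⁆ = zero , sym (x∈⁅y⁆⇒x≡y _ v∈⁅g0⁆)

image-⊆ : ∀ (g : Fin m → Fin n) {D} → (∀ j → g j ∈ D) → image g ⊆ D
image-⊆ g g∈D v∈ with j , refl ← ∈-image⁻ g v∈ = g∈D j

injective⇒∣image∣≡m : ∀ (g : Fin m → Fin n) → Injective _≡_ _≡_ g → ∣ image g ∣ ≡ m
injective⇒∣image∣≡m {zero} {n} g _ = ∣⊥∣≡0 n
injective⇒∣image∣≡m {suc m} g g-inj =
  trans (∣p∪⁅x⁆∣≡1+∣p∣ g0∉) (cong suc (injective⇒∣image∣≡m (g ∘ suc) (suc-injective ∘ g-inj)))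
  where
  g0∉ : g zero ∉ image (g ∘ suc)
  g0∉ g0∈ with j , e ← ∈-image⁻ (g ∘ suc) g0∈ = 0≢1+n (g-inj (sym e))

injective∧∣D∣≤m⇒D⊆image : ∀ (g : Fin m → Fin n) {D} → Injective _≡_ _≡_ g →
  (∀ j → g j ∈ D) → ∣ D ∣ ≤ m → D ⊆ image g
injective∧∣D∣≤m⇒D⊆image g g-inj g∈D ∣D∣≤m with p⊆q⇒q⊆p⊎∣p∣<∣q∣ (image-⊆ g g∈D)
... | inj₁ D⊆ = D⊆
... | inj₂ m<∣D∣ = contradiction ∣D∣≤m (<⇒≱ (subst (_< _) (injective⇒∣image∣≡m g g-inj) m<∣D∣))

module _ (F : Subset n → Subset n) (F-inflationary : ∀ p → p ⊆ F p) where

  private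
    closed-step : ∀ {q} → F q ⊆ q → F (F q) ⊆ F q
    closed-step {q} closed = subst (λ r → F r ⊆ r) (⊆-antisym (F-inflationary q) closed) closed

    closed-or-large : ∀ p m → F (fold p F m) ⊆ fold p F m ⊎ m ≤ ∣ fold p F m ∣
    closed-or-large p zero = inj₂ z≤n
    closed-or-large p (suc m) with closed-or-large p m
    ... | inj₁ closed = inj₁ (closed-step closed)
    ... | inj₂ large with p⊆q⇒q⊆p⊎∣p∣<∣q∣ (F-inflationary (fold p F m))
    ...   | inj₁ closed = inj₁ (closed-step closed)
    ...   | inj₂ grows = inj₂ (≤-trans (s≤s large) grows)

  fold-⊇ : ∀ p m → p ⊆ fold p F m
  fold-⊇ p zero = λ x∈p → x∈p
  fold-⊇ p (suc m) = F-inflationary _ ∘ fold-⊇ p m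

  -- A chain of subsets of Fin n cannot grow strictly n + 1 times.
  fold-closed : ∀ p → F (fold p F (suc n)) ⊆ fold p F (suc n)
  fold-closed p with closed-or-large p (suc n)
  ... | inj₁ closed = closed
  ... | inj₂ large = contradiction (∣p∣≤n (fold p F (suc n))) (<⇒≱ large)

EdgeClosed : Graph n → Subset n → Subset n → Set
EdgeClosed G W C = ∀ {v w} → v ∈ C → w ∉ W → Edge G v w → w ∈ C

Reach⇒∉ : ∀ {G : Graph n} {W u v} → Reach G W u v → v ∉ W
Reach⇒∉ (here v∉W) = v∉W
Reach⇒∉ (step _ _ v∉W) = v∉W

module Component (G : Graph n) (W : Subset n) where

  Boundary : Subset n → Fin n → Set
  Boundary S w = w ∉ W × ∃ λ v → v ∈ S × Edge G v w

  boundary? : ∀ S → Decidable (Boundary S)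
  boundary? S w = ¬? (w ∈? W) ×-dec any? λ v → (v ∈? S) ×-dec (adj G v w Bool.≟ true)

  boundary : Subset n → Subset n
  boundary S = subset (boundary? S)

  grow : Subset n → Subset n
  grow S = S ∪ boundary S

  grow-⊇ : ∀ S → S ⊆ grow S
  grow-⊇ S = p⊆p∪q (boundary S)

  component : Fin n → Subset n
  component y = fold ⁅ y ⁆ grow (suc n)

  ∈-component : ∀ y → y ∈ component y
  ∈-component y = fold-⊇ grow grow-⊇ ⁅ y ⁆ (suc n) (x∈⁅x⁆ y)

  component-closed : ∀ y → EdgeClosed G W (component y)
  component-closed y v∈C w∉W vw =
    fold-closed grow grow-⊇ ⁅ y ⁆ (q⊆p∪q _ _ (∈-subset⁺ (boundary? _) (w∉W , _ , v∈C , vw)))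

  component-reach : ∀ {y} → y ∉ W → ∀ {v} → v ∈ component y → Reach G W y v
  component-reach {y} y∉W = fold-reach (suc n)
    where
    fold-reach : ∀ m {v} → v ∈ fold ⁅ y ⁆ grow m → Reach G W y v
    fold-reach zero v∈⁅y⁆ rewrite x∈⁅y⁆⇒x≡y y v∈⁅y⁆ = here y∉W
    fold-reach (suc m) v∈ with x∈p∪q⁻ _ _ v∈
    ... | inj₁ v∈′ = fold-reach m v∈′
    ... | inj₂ v∈∂ with v∉W , u , u∈ , uv ← ∈-subset⁻ (boundary? _) v∈∂ =
      step (fold-reach m u∈) uv v∉W

PairwiseAdjacent : ∀ {c} → Graph n → (Fin c → Fin n) → Set
PairwiseAdjacent G h = ∀ a b → a ≢ b → Edge G (h a) (h b)

InsideOrOutside : ∀ {c} → Subset n → (Fin c → Fin n) → Set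
InsideOrOutside C h = (∀ a → h a ∈ C) ⊎ (∀ a → h a ∉ C)

spread : ∀ {c} {G : Graph n} {W C} {h : Fin c → Fin n} → EdgeClosed G W C → PairwiseAdjacent G h →
  ∀ a b → h a ∈ C → h b ∉ W → h b ∈ C
spread closed adjacent a b ha∈C hb∉W with b ≟ a
... | yes refl = ha∈C
... | no b≢a = closed ha∈C hb∉W (adjacent a b (b≢a ∘ sym))

inside-or-outside : ∀ {c} {G : Graph n} {W C} {h : Fin c → Fin n} → EdgeClosed G W C →
  PairwiseAdjacent G h → (∀ a → h a ∉ W) → InsideOrOutside C h
inside-or-outside {c = zero} _ _ _ = inj₁ λ ()
inside-or-outside {c = suc _} {G = G} {C = C} {h} closed adjacent h∉W with h zero ∈? C
... | yes h₀∈C = inj₁ λ a → spread {G = G} {h = h} closed adjacent zero a h₀∈C (h∉W a)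
... | no h₀∉C = inj₂ λ a ha∈C → h₀∉C (spread {G = G} {h = h} closed adjacent a zero ha∈C (h∉W zero))

InsideOrOutside-─ : ∀ {c} {C D : Subset n} {h : Fin c → Fin n} →
  InsideOrOutside C h → (∀ a → h a ∉ D) → InsideOrOutside (C ─ D) h
InsideOrOutside-─ (inj₁ h⊆C) h∉D = inj₁ λ a → x∈p∧x∉q⇒x∈p─q (h⊆C a) (h∉D a)
InsideOrOutside-─ {C = C} {D} (inj₂ h∩C≡∅) _ = inj₂ λ a → h∩C≡∅ a ∘ p─q⊆p C D

IsClique-⊆ : ∀ {G : Graph n} {C D} → C ⊆ D → IsClique G D → IsClique G C
IsClique-⊆ C⊆D D-clique u v u∈C v∈C = D-clique u v (C⊆D u∈C) (C⊆D v∈C)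

image-clique : ∀ {c} {G : Graph n} {h : Fin c → Fin n} → PairwiseAdjacent G h → IsClique G (image h)
image-clique {h = h} adjacent u v u∈ v∈ u≢v
  with a , refl ← ∈-image⁻ h u∈ | b , refl ← ∈-image⁻ h v∈ = adjacent a b (u≢v ∘ cong h)

Covers : ∀ {p c} → (Fin p × Fin c → Fin n) → Subset n → Set
Covers f D = ∀ {v} → v ∈ D → ∃ λ ia → f ia ≡ v

placement-covers : ∀ {p c} {S : Subset n} (f : Fin p × Fin c → Fin n) → Injective _≡_ _≡_ f →
  (∀ i a → f (i , a) ∉ S) → ∣ ∁ S ∣ ≤ p * c → Covers f (∁ S)
placement-covers {p = p} {c} f f-inj f∉S ∣∁S∣≤pc v∈∁S =
  Product.map (remQuot c) id
    (∈-image⁻ g (injective∧∣D∣≤m⇒D⊆image g g-inj (λ j → x∉p⇒x∈∁p (f∉S _ _)) ∣∁S∣≤pc v∈∁S))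
  where
  g : Fin (p * c) → Fin _
  g = f ∘ remQuot c
  g-inj : Injective _≡_ _≡_ g
  g-inj {i} {j} e = begin
    i                                 ≡⟨ combine-remQuot {p} c i ⟨
    uncurry combine (remQuot {p} c i) ≡⟨ cong (uncurry combine) (f-inj e) ⟩
    uncurry combine (remQuot {p} c j) ≡⟨ combine-remQuot {p} c j ⟩
    j                                 ∎
    where open ≡-Reasoning

blocks-divide : ∀ {p c} (f : Fin p × Fin c → Fin n) → Injective _≡_ _≡_ f → ∀ {C} →
  Covers f C → (∀ i → InsideOrOutside C (curry f i)) → c ∣ ∣ C ∣
blocks-divide {n} {zero} {c} f _ {C} covers _ = subst (c ∣_) (sym ∣C∣≡0) (c ∣0)
  where
  ∣C∣≡0 : ∣ C ∣ ≡ 0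
  ∣C∣≡0 = trans (cong ∣_∣ (Empty-unique λ (_ , v∈C) → ¬Fin0 (proj₁ (proj₁ (covers v∈C))))) (∣⊥∣≡0 n)
blocks-divide {p = suc p} {c} f f-inj {C} covers inside-or-outside =
  by-block₀ (inside-or-outside zero)
  where
  block₀ : Fin c → Fin _
  block₀ = curry f zero
  f′ : Fin p × Fin c → Fin _
  f′ (i , a) = f (suc i , a)
  f′-inj : Injective _≡_ _≡_ f′
  f′-inj {i , a} {j , b} e with refl ← f-inj e = refl
  f′-covers : ∀ {D} → (∀ a → block₀ a ∉ D) → Covers f D → Covers f′ D
  f′-covers block₀∉D covers v∈D with covers v∈D
  ... | (zero , a) , refl = contradiction v∈D (block₀∉D a)
  ... | (suc i , a) , e = (i , a) , e
  block₀∉rest : ∀ i a → f (suc i , a) ∉ image block₀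
  block₀∉rest i a ∈block₀ with b , e ← ∈-image⁻ block₀ ∈block₀ = 0≢1+n (cong proj₁ (f-inj e))
  by-block₀ : InsideOrOutside C block₀ → c ∣ ∣ C ∣
  by-block₀ (inj₁ block₀⊆C) = subst (c ∣_) (sym ∣C∣≡c+∣C′∣) (∣m∣n⇒∣m+n ∣-refl
      (blocks-divide f′ f′-inj
        (f′-covers (λ a → x∈q⇒x∉p─q C _ (∈-image block₀ a)) (covers ∘ p─q⊆p C _))
        rest-inside-or-outside))
    where
    C′ : Subset _
    C′ = C ─ image block₀
    ∣C∣≡c+∣C′∣ : ∣ C ∣ ≡ c + ∣ C′ ∣
    ∣C∣≡c+∣C′∣ = trans (∣p∣≡∣q∣+∣p─q∣ (image-⊆ block₀ block₀⊆C))
                       (cong (_+ ∣ C′ ∣) (injective⇒∣image∣≡m block₀ (,-injectiveʳ ∘ f-inj)))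
    rest-inside-or-outside : ∀ i → InsideOrOutside C′ (curry f′ i)
    rest-inside-or-outside i with inside-or-outside (suc i)
    ... | inj₁ block⊆C = inj₁ λ a → x∈p∧x∉q⇒x∈p─q (block⊆C a) (block₀∉rest i a)
    ... | inj₂ block∩C≡∅ = inj₂ λ a → block∩C≡∅ a ∘ p─q⊆p C _
  by-block₀ (inj₂ block₀∩C≡∅) =
    blocks-divide f′ f′-inj (f′-covers block₀∩C≡∅ covers) (inside-or-outside ∘ suc)

swap : Subset n → Fin n → Fin n → Subset n
swap W x y = (W - x) ∪ ⁅ y ⁆

module _ {W : Subset n} {x y : Fin n} where

  ∣swap∣≡ : x ∈ W → y ∉ W → ∣ swap W x y ∣ ≡ ∣ W ∣
  ∣swap∣≡ x∈W y∉W = trans (∣p∪⁅x⁆∣≡1+∣p∣ (y∉W ∘ p─q⊆p W _)) (sym (∣p∣≡1+∣p-x∣ x∈W))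

  x∉swap : x ∈ W → y ∉ W → x ∉ swap W x y
  x∉swap x∈W y∉W =
    [ x∈q⇒x∉p─q W _ (x∈⁅x⁆ x) , (λ x∈⁅y⁆ → y∉W (subst (_∈ W) (x∈⁅y⁆⇒x≡y y x∈⁅y⁆) x∈W)) ] ∘ x∈p∪q⁻ _ _

  ∉swap⁺ : ∀ {v} → v ∉ W → v ≢ y → v ∉ swap W x y
  ∉swap⁺ v∉W v≢y = [ v∉W ∘ p─q⊆p W _ , v≢y ∘ x∈⁅y⁆⇒x≡y y ] ∘ x∈p∪q⁻ _ _

  ∉swap⁻ : ∀ {v} → v ∉ swap W x y → v ≢ x → v ∉ W
  ∉swap⁻ v∉S v≢x v∈W = v∉S (p⊆p∪q _ (x∈p∧x≢y⇒x∈p-y v∈W v≢x))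

CliqueCompletion : Graph n → Fin n → Subset n → ℕ → Set
CliqueCompletion {n} G x C m = Σ (Subset n) λ V → ∣ V ∣ ≡ m × V ⊆ C × IsClique G (⁅ x ⁆ ∪ V)

module _ {G : Graph n} {W : Subset n} {y : Fin n} (y∉W : y ∉ W) where
  open Component G W

  component-∉ : ∀ {v} → v ∈ component y → v ∉ W
  component-∉ = Reach⇒∉ ∘ component-reach y∉W

  component-divisible : ∀ {p c} → ContainsPKc-avoiding G W p c → ∣ ∁ W ∣ ≤ p * c →
    c ∣ ∣ component y ∣
  component-divisible (f , f-inj , f∉W , f-adjacent) ∣∁W∣≤pc =
    blocks-divide f f-inj
      (λ v∈C → placement-covers f f-inj f∉W ∣∁W∣≤pc (x∉p⇒x∈∁p (component-∉ v∈C)))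
      (λ i → inside-or-outside {G = G} (component-closed y) (f-adjacent i) (f∉W i))

  private
    module Placement {x : Fin n} (x∈W : x ∈ W) {p c} (f : Fin p × Fin (suc (suc c)) → Fin n)
             (f-inj : Injective _≡_ _≡_ f) (f∉S : ∀ i a → f (i , a) ∉ swap W x y)
             (f-adjacent : ∀ i → PairwiseAdjacent G (curry f i))
             (∣∁S∣≤pc : ∣ ∁ (swap W x y) ∣ ≤ p * suc (suc c)) where

      C : Subset n
      C = component y

      covers : ∀ {v} → v ∉ swap W x y → ∃ λ ia → f ia ≡ v
      covers = placement-covers f f-inj f∉S ∣∁S∣≤pc ∘ x∉p⇒x∈∁p

      x-position : ∃ λ ia → f ia ≡ x
      x-position = covers (x∉swap x∈W y∉W)

      i₀ : Fin p
      i₀ = proj₁ (proj₁ x-position)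

      a₀ : Fin (suc (suc c))
      a₀ = proj₂ (proj₁ x-position)

      f≢x : ∀ {i a} → (i , a) ≢ (i₀ , a₀) → f (i , a) ≢ x
      f≢x ≢i₀a₀ f[i,a]≡x = ≢i₀a₀ (f-inj (trans f[i,a]≡x (sym (proj₂ x-position))))

      others : Fin (suc c) → Fin n
      others j = f (i₀ , punchIn a₀ j)

      others-∉W : ∀ j → others j ∉ W
      others-∉W j = ∉swap⁻ (f∉S i₀ _) (f≢x (punchInᵢ≢i a₀ j ∘ ,-injectiveʳ))

      others-inj : Injective _≡_ _≡_ others
      others-inj e = punchIn-injective a₀ _ _ (,-injectiveʳ (f-inj e))

      others-adjacent : PairwiseAdjacent G others
      others-adjacent j j′ j≢j′ = f-adjacent i₀ _ _ (j≢j′ ∘ punchIn-injective a₀ j j′)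

      x∪others⊆block : ⁅ x ⁆ ∪ image others ⊆ image (curry f i₀)
      x∪others⊆block = [ (λ v∈⁅x⁆ → subst (_∈ _) (trans (proj₂ x-position) (sym (x∈⁅y⁆⇒x≡y x v∈⁅x⁆)))
                                                 (∈-image (curry f i₀) a₀))
                       , image-⊆ others (∈-image (curry f i₀) ∘ punchIn a₀) ] ∘ x∈p∪q⁻ _ _

      others-completion : others zero ∈ C → CliqueCompletion G x C (suc c)
      others-completion others₀∈C =
        image others ,
        injective⇒∣image∣≡m others others-inj ,
        image-⊆ others (λ j → spread {G = G} (component-closed y) others-adjacent zero j
                                         others₀∈C (others-∉W j)) ,
        IsClique-⊆ {G = G} x∪others⊆block (image-clique {G = G} (f-adjacent i₀))

      C-y-divisible : others zero ∉ C → suc (suc c) ∣ ∣ C - y ∣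
      C-y-divisible others₀∉C = blocks-divide f f-inj covers-C-y λ i →
          InsideOrOutside-─ (block-inside-or-outside i) λ a → f∉S i a ∘ q⊆p∪q _ _
        where
        covers-C-y : Covers f (C - y)
        covers-C-y v∈C-y = covers (∉swap⁺ (component-∉ (p─q⊆p C _ v∈C-y))
                                          λ { refl → x∈q⇒x∉p─q C _ (x∈⁅x⁆ y) v∈C-y })
        block-inside-or-outside : ∀ i → InsideOrOutside C (curry f i)
        block-inside-or-outside i with i ≟ i₀
        ... | yes refl = inj₂ λ a f[i₀,a]∈C →
          others₀∉C (spread {G = G} (component-closed y) (f-adjacent i₀) a _
                                f[i₀,a]∈C (others-∉W zero))
        ... | no i≢i₀ = inside-or-outside {G = G} (component-closed y) (f-adjacent i)
                          λ a → ∉swap⁻ (f∉S i a) (f≢x (i≢i₀ ∘ ,-injectiveˡ))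

      completion-or-divisible : CliqueCompletion G x C (suc c) ⊎ suc (suc c) ∣ ∣ C - y ∣
      completion-or-divisible with others zero ∈? C
      ... | yes others₀∈C = inj₁ (others-completion others₀∈C)
      ... | no others₀∉C = inj₂ (C-y-divisible others₀∉C)

  completion-or-divisible : ∀ {x} → x ∈ W → ∀ {p c} →
    ContainsPKc-avoiding G (swap W x y) p (suc (suc c)) → ∣ ∁ (swap W x y) ∣ ≤ p * suc (suc c) →
    CliqueCompletion G x (component y) (suc c) ⊎ suc (suc c) ∣ ∣ component y - y ∣
  completion-or-divisible x∈W (f , f-inj , f∉S , f-adjacent) =
    Placement.completion-or-divisible x∈W f f-inj f∉S f-adjacent

lemma7 : (k p c : ℕ) → 1 ≤ p → 3 ≤ c → k < c →
    (G : Graph (p * c + k)) → FT k p c G →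
    (W : Subset (p * c + k)) → ∣ W ∣ ≡ k → Separator G W →
    (x : Fin (p * c + k)) → x ∈ W →
    (y : Fin (p * c + k)) → y ∉ W →
    Σ (Subset (p * c + k)) λ V →
    ∣ V ∣ ≡ c ∸ 1 × (∀ v → v ∈ V → Reach G W y v) × IsClique G (⁅ x ⁆ ∪ V)
lemma7 k p (suc (suc c)) _ (s≤s (s≤s _)) _ G ft W ∣W∣≡k _ x x∈W y y∉W =
  [ reachable-completion , ⊥-elim ∘ C-y-indivisible ]
    (completion-or-divisible {G = G} y∉W x∈W
      (ft S (≤-reflexive ∣S∣≡k)) (≤-reflexive (∣p∣≡k⇒∣∁p∣≡m S ∣S∣≡k)))
  where
  open Component G W
  S : Subset (p * suc (suc c) + k)
  S = swap W x y
  ∣S∣≡k : ∣ S ∣ ≡ k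
  ∣S∣≡k = trans (∣swap∣≡ x∈W y∉W) ∣W∣≡k
  C-divisible : suc (suc c) ∣ ∣ component y ∣
  C-divisible = component-divisible {G = G} y∉W
    (ft W (≤-reflexive ∣W∣≡k)) (≤-reflexive (∣p∣≡k⇒∣∁p∣≡m W ∣W∣≡k))
  C-y-indivisible : ¬ (suc (suc c) ∣ ∣ component y - y ∣)
  C-y-indivisible C-y-divisible
    with () ← ∣1+m∧∣m⇒≡1 (subst (_ ∣_) (∣p∣≡1+∣p-x∣ (∈-component y)) C-divisible) C-y-divisible
  reachable-completion : CliqueCompletion G x (component y) (suc c) →
    Σ (Subset (p * suc (suc c) + k)) λ V →
    ∣ V ∣ ≡ suc c × (∀ v → v ∈ V → Reach G W y v) × IsClique G (⁅ x ⁆ ∪ V)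
  reachable-completion (V , ∣V∣≡ , V⊆C , clique) =
    V , ∣V∣≡ , (λ _ → component-reach y∉W ∘ V⊆C) , clique
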